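{- Let $p\ge2$ and let $m_1,\dots,m_p$ be positive integers. The set $\mathcal{S}^p$ is divided into $2^{p-1}$ orbits, the points of each orbit having the same index. For $(\delta_1,\dots,\delta_{p-1})\in\{0,1\}^{p-1}$, the orbit $S_{(\delta_1,\dots,\delta_{p-1})}=\{P\in\mathcal{S}^p: I(P)=(\delta_1,\dots,\delta_{p-1})\}$ satisfies, with $\delta_0=0$, \[|S_{(\delta_1,\dots,\delta_{p-1})}|=\prod_{i=1}^{p}\frac{(m_i+1)+(-1)^{[\delta_{i-1}]_2}[m_i+1]_2}{2}+\prod_{i=1}^{p}\frac{(m_i+1)+(-1)^{[\delta_{i-1}+1]_2}[m_i+1]_2}{2}.\]
   Context: $\mathcal{S}^p=\{(x_1,\dots,x_p)\in\mathbb{Z}^p: 0\le x_i\le m_i\}$. A diagonal move takes $P\in\mathcal{S}^p$ to $Q\in\mathcal{S}^p$ with $Q-P\in\{\pm1\}^p$; orbits are the classes of points mutually reachable by finite sequences of diagonal moves (equivalently, orbits of the group generated by the maps $(x_i)_i\mapsto(\varphi_{m_i}(x_i\pm1))_i$ with independent signs, $\varphi_m(u)=\min_{n\in\mathbb{Z}}|u-2nm|$). For an integer $a$, $[a]_2\in\{0,1\}$ denotes its residue mod $2$. The index of $P=(x_1,\dots,x_p)$ is $I(P)=([x_1+x_2]_2,\dots,[x_1+x_p]_2)$. -}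

module Defs where

open import Data.Nat using (ℕ; zero; suc; _+_; _≤_)
open import Data.Nat.DivMod using (_mod_)
open import Data.Fin using (Fin; toℕ)
open import Data.Integer as ℤ using (ℤ; +_; -_)
open import Data.Integer.DivMod using (_/ℕ_)
open import Data.Vec using (Vec; []; _∷_; map)
open import Data.Vec.Relation.Binary.Pointwise.Inductive using (Pointwise)
open import Data.Product using (Σ; proj₁)
open import Data.Sum using (_⊎_)
open import Relation.Binary.PropositionalEquality using (_≡_)
open import Relation.Binary.Construct.Closure.ReflexiveTransitive using (Star)

[_]₂ : ℕ → Fin 2
[ a ]₂ = a mod 2

InS : ∀ {p} → Vec ℕ p → Vec ℕ p → Set
InS m x = Pointwise _≤_ x m

Point : ∀ {p} → Vec ℕ p → Set
Point {p} m = Σ (Vec ℕ p) (InS m)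

DiagMove : ∀ {p} (m : Vec ℕ p) → Point m → Point m → Set
DiagMove m P Q = Pointwise (λ a b → (b ≡ suc a) ⊎ (a ≡ suc b)) (proj₁ P) (proj₁ Q)

Reachable : ∀ {p} (m : Vec ℕ p) → Point m → Point m → Set
Reachable m = Star (DiagMove m)

index : ∀ {q} → Vec ℕ (suc q) → Vec (Fin 2) q
index (x₁ ∷ xs) = map (λ y → [ x₁ + y ]₂) xs

S[_] : ∀ {q} {m : Vec ℕ (suc q)} → Vec (Fin 2) q → Set
S[_] {m = m} δ = Σ (Point m) (λ P → index (proj₁ P) ≡ δ)

neg1^ : ℕ → ℤ
neg1^ zero = + 1
neg1^ (suc k) = ℤ.- neg1^ k

factor : ℕ → ℕ → ℤ
factor e m = ((+ (suc m)) ℤ.+ neg1^ e ℤ.* (+ toℕ [ suc m ]₂)) /ℕ 2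

prodFactors : ∀ {p} → Vec ℕ p → Vec ℕ p → ℤ
prodFactors [] [] = + 1
prodFactors (e ∷ es) (m ∷ ms) = factor e m ℤ.* prodFactors es ms

-- The exponent vectors: [δ_{i-1}]_2 and [δ_{i-1}+1]_2 with δ_0 = 0
exps₀ : ∀ {q} → Vec (Fin 2) q → Vec ℕ (suc q)
exps₀ δ = toℕ [ 0 ]₂ ∷ map (λ d → toℕ [ toℕ d ]₂) δ

exps₁ : ∀ {q} → Vec (Fin 2) q → Vec ℕ (suc q)
exps₁ δ = toℕ [ 0 + 1 ]₂ ∷ map (λ d → toℕ [ toℕ d + 1 ]₂) δ

orbitSizeFormula : ∀ {q} → Vec ℕ (suc q) → Vec (Fin 2) q → ℤ
orbitSizeFormula m δ = prodFactors (exps₀ δ) m ℤ.+ prodFactors (exps₁ δ) m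

{-# OPTIONS --safe #-}

-- A diagonal move flips the parity of every coordinate, hence preserves the
-- parities of all x₁ + xᵢ, i.e. the index.  Conversely, iterating N ≥ max mᵢ
-- times the move that lowers every coordinate by one (and raises 0 to 1) lands
-- on the 0/1-vector of the parities of xᵢ + N.  Two points of equal index have
-- parity vectors differing by a constant c, so they land on the same point
-- after N and N + c iterations respectively.
-- A point has index δ iff its parity vector is (c, c + δ₁, …, c + δ_{p-1}),
-- c being the parity of x₁.  So S_δ is the disjoint union, over c, of two boxes
-- of points with prescribed coordinate parities; such a box has ∏ᵢ nᵢ points,
-- where nᵢ = ⌈(mᵢ+1)/2⌉ or ⌊(mᵢ+1)/2⌋ as the i-th parity is even or odd.
module Submission where

open import Defs
open import Axiom.UniquenessOfIdentityProofs.WithK using (uip)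
open import Data.Fin as Fin using (Fin; toℕ; fromℕ<)
open import Data.Fin.Patterns using (0F; 1F)
open import Data.Fin.Properties using (toℕ-injective; toℕ-fromℕ<; toℕ<n; *↔×; +↔⊎)
open import Data.Integer as ℤ using (+_)
open import Data.Integer.DivMod using (_/ℕ_)
open import Data.Integer.Properties using (pos-+; pos-*)
open import Data.Nat using (ℕ; zero; suc; _+_; _*_; _/_; _≤_; _<_; z≤n; s≤s; s≤s⁻¹; ⌊_/2⌋; ⌈_/2⌉; parity)
open import Data.Nat.DivMod using (m/n≡1+[m∸n]/n)
open import Data.Nat.GeneralisedArithmetic using (iterate)
open import Data.Nat.Properties using (≤-irrelevant; ≤-trans; m≤m+n; m≤n+m; m≤n⇒m≤1+n; +-suc; +-identityʳ; +-comm; *-mono-≤)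
open import Data.Parity.Base as ℙ using (Parity; 0ℙ; 1ℙ; _⁻¹)
open import Data.Parity.Properties as ℙₚ using (suc-homo-⁻¹; +-homo-+; p+p≡0ℙ)
open import Data.Product using (Σ; _×_; _,_; proj₁)
open import Data.Product.Function.NonDependent.Propositional using (_×-↔_)
open import Data.Sum using (_⊎_; inj₁; inj₂; swap)
open import Data.Sum.Function.Propositional using (_⊎-↔_)
open import Data.Vec using (Vec; []; _∷_; map; head; sum)
open import Data.Vec.Properties using (map-∘; map-cong; map-id; ∷-injectiveˡ; ∷-injectiveʳ)
open import Data.Vec.Relation.Unary.All as All using (All; []; _∷_)
open import Data.Vec.Relation.Binary.Pointwise.Inductive as Pointwise using (Pointwise; []; _∷_)
open import Function.Base using (_∘_)
open import Function.Bundles using (_⇔_; _↔_; mk⇔; mk↔ₛ′; Equivalence)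
open import Function.Properties.Inverse using (↔-trans)
open import Relation.Binary.Definitions using (Irrelevant)
open import Relation.Binary.PropositionalEquality
open import Function.Related.Propositional using (module EquationalReasoning)
open import Relation.Binary.Construct.Closure.ReflexiveTransitive using (ε; _◅_; _◅◅_; reverse)

open Equivalence using (to; from)

toFin₂ : Parity → Fin 2
toFin₂ 0ℙ = 0F
toFin₂ 1ℙ = 1F

fromFin₂ : Fin 2 → Parity
fromFin₂ 0F = 0ℙ
fromFin₂ 1F = 1ℙ

fromFin₂∘toFin₂ : ∀ p → fromFin₂ (toFin₂ p) ≡ p
fromFin₂∘toFin₂ 0ℙ = refl
fromFin₂∘toFin₂ 1ℙ = refl

toFin₂∘fromFin₂ : ∀ d → toFin₂ (fromFin₂ d) ≡ d
toFin₂∘fromFin₂ 0F = refl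
toFin₂∘fromFin₂ 1F = refl

[n]₂≡toFin₂-parity : ∀ n → [ n ]₂ ≡ toFin₂ (parity n)
[n]₂≡toFin₂-parity zero = refl
[n]₂≡toFin₂-parity (suc zero) = refl
[n]₂≡toFin₂-parity (suc (suc n)) = [n]₂≡toFin₂-parity n

bit : Parity → ℕ
bit 0ℙ = 0
bit 1ℙ = 1

parity-bit : ∀ p → parity (bit p) ≡ p
parity-bit 0ℙ = refl
parity-bit 1ℙ = refl

parity-suc : ∀ n → parity (suc n) ≡ parity n ⁻¹
parity-suc zero = refl
parity-suc (suc zero) = refl
parity-suc (suc (suc n)) = parity-suc n

relative : ∀ {q} → Vec Parity (suc q) → Vec Parity q
relative (c ∷ ps) = map (c ℙ.+_) ps

fromRelative : ∀ {q} → Parity → Vec Parity q → Vec Parity (suc q)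
fromRelative c ρ = c ∷ map (c ℙ.+_) ρ

map-+-map-+ : ∀ c d {q} (ps : Vec Parity q) → map (c ℙ.+_) (map (d ℙ.+_) ps) ≡ map ((c ℙ.+ d) ℙ.+_) ps
map-+-map-+ c d ps = trans (sym (map-∘ _ _ ps)) (map-cong (λ p → sym (ℙₚ.+-assoc c d p)) ps)

relative-fromRelative : ∀ {q} c (ρ : Vec Parity q) → relative (fromRelative c ρ) ≡ ρ
relative-fromRelative c ρ = trans (map-+-map-+ c c ρ) (trans (cong (λ d → map (d ℙ.+_) ρ) (p+p≡0ℙ c)) (map-id ρ))

fromRelative-relative : ∀ {q} (v : Vec Parity (suc q)) → fromRelative (head v) (relative v) ≡ v
fromRelative-relative (c ∷ ps) = cong (c ∷_) (relative-fromRelative c ps)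

map-+-fromRelative : ∀ {q} c d (ρ : Vec Parity q) → map (c ℙ.+_) (fromRelative d ρ) ≡ fromRelative (c ℙ.+ d) ρ
map-+-fromRelative c d ρ = cong ((c ℙ.+ d) ∷_) (map-+-map-+ c d ρ)

relative-map-+ : ∀ {q} c (v : Vec Parity (suc q)) → relative (map (c ℙ.+_) v) ≡ relative v
relative-map-+ c v = begin
  relative (map (c ℙ.+_) v)                                    ≡⟨ cong (relative ∘ map (c ℙ.+_)) (sym (fromRelative-relative v)) ⟩
  relative (map (c ℙ.+_) (fromRelative (head v) (relative v))) ≡⟨ cong relative (map-+-fromRelative c (head v) (relative v)) ⟩
  relative (fromRelative (c ℙ.+ head v) (relative v))          ≡⟨ relative-fromRelative (c ℙ.+ head v) (relative v) ⟩
  relative v                                                   ∎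
  where open ≡-Reasoning

relative-injective : ∀ {q} (v w : Vec Parity (suc q)) → relative v ≡ relative w →
                     v ≡ map ((head v ℙ.+ head w) ℙ.+_) w
relative-injective v w eq = begin
  v                                                   ≡⟨ sym (fromRelative-relative v) ⟩
  fromRelative (head v) (relative v)                  ≡⟨ cong₂ fromRelative (sym cancel) eq ⟩
  fromRelative ((head v ℙ.+ head w) ℙ.+ head w) (relative w) ≡⟨ sym (map-+-fromRelative (head v ℙ.+ head w) (head w) (relative w)) ⟩
  map ((head v ℙ.+ head w) ℙ.+_) (fromRelative (head w) (relative w)) ≡⟨ cong (map _) (fromRelative-relative w) ⟩
  map ((head v ℙ.+ head w) ℙ.+_) w                    ∎
  where
  open ≡-Reasoning
  cancel : (head v ℙ.+ head w) ℙ.+ head w ≡ head v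
  cancel = trans (ℙₚ.+-assoc (head v) _ _) (trans (cong (head v ℙ.+_) (p+p≡0ℙ (head w))) (ℙₚ.+-identityʳ _))

index≡relative : ∀ {q} (x : Vec ℕ (suc q)) → index x ≡ map toFin₂ (relative (map parity x))
index≡relative (x₁ ∷ xs) = begin
  map (λ y → [ x₁ + y ]₂) xs                          ≡⟨ map-cong (λ y → trans ([n]₂≡toFin₂-parity (x₁ + y)) (cong toFin₂ (+-homo-+ x₁ y))) xs ⟩
  map (λ y → toFin₂ (parity x₁ ℙ.+ parity y)) xs      ≡⟨ map-∘ toFin₂ _ xs ⟩
  map toFin₂ (map (λ y → parity x₁ ℙ.+ parity y) xs)  ≡⟨ cong (map toFin₂) (map-∘ _ parity xs) ⟩
  map toFin₂ (map (parity x₁ ℙ.+_) (map parity xs))   ∎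
  where open ≡-Reasoning

map-toFin₂≡⇔ : ∀ {q} (ρ : Vec Parity q) δ → map toFin₂ ρ ≡ δ ⇔ ρ ≡ map fromFin₂ δ
map-toFin₂≡⇔ ρ δ = mk⇔
  (λ eq → trans (sym (fromFin₂-inverse ρ)) (cong (map fromFin₂) eq))
  (λ eq → trans (cong (map toFin₂) eq) (trans (sym (map-∘ _ _ δ)) (trans (map-cong toFin₂∘fromFin₂ δ) (map-id δ))))
  where
  fromFin₂-inverse : ∀ {q} (ρ : Vec Parity q) → map fromFin₂ (map toFin₂ ρ) ≡ ρ
  fromFin₂-inverse ρ = trans (sym (map-∘ _ _ ρ)) (trans (map-cong fromFin₂∘toFin₂ ρ) (map-id ρ))

index≡⇔relative≡ : ∀ {q} (x : Vec ℕ (suc q)) δ → index x ≡ δ ⇔ relative (map parity x) ≡ map fromFin₂ δ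
index≡⇔relative≡ x δ = mk⇔
  (to (map-toFin₂≡⇔ _ δ) ∘ trans (sym (index≡relative x)))
  (trans (index≡relative x) ∘ from (map-toFin₂≡⇔ _ δ))

-- Diagonal moves preserve the index

Adjacent : ℕ → ℕ → Set
Adjacent a b = (b ≡ suc a) ⊎ (a ≡ suc b)

parity-adjacent : ∀ {a b} → Adjacent a b → parity b ≡ 1ℙ ℙ.+ parity a
parity-adjacent {a} (inj₁ refl) = parity-suc a
parity-adjacent {b = b} (inj₂ refl) = sym (suc-homo-⁻¹ b)

parities-adjacent : ∀ {p} {x y : Vec ℕ p} → Pointwise Adjacent x y →
                    map parity y ≡ map (1ℙ ℙ.+_) (map parity x)
parities-adjacent [] = refl
parities-adjacent (r ∷ rs) = cong₂ _∷_ (parity-adjacent r) (parities-adjacent rs)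

index-move : ∀ {q} {m : Vec ℕ (suc q)} {P Q : Point m} → DiagMove m P Q → index (proj₁ P) ≡ index (proj₁ Q)
index-move {P = x , _} {y , _} move = begin
  index x                                               ≡⟨ index≡relative x ⟩
  map toFin₂ (relative (map parity x))                  ≡⟨ cong (map toFin₂) (sym (relative-map-+ 1ℙ (map parity x))) ⟩
  map toFin₂ (relative (map (1ℙ ℙ.+_) (map parity x)))  ≡⟨ cong (map toFin₂ ∘ relative) (sym (parities-adjacent move)) ⟩
  map toFin₂ (relative (map parity y))                  ≡⟨ sym (index≡relative y) ⟩
  index y                                               ∎
  where open ≡-Reasoning

index-reachable : ∀ {q} {m : Vec ℕ (suc q)} {P Q : Point m} → Reachable m P Q → index (proj₁ P) ≡ index (proj₁ Q)
index-reachable ε = refl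
index-reachable {P = P} (_◅_ {j = R} move moves) = trans (index-move {P = P} {R} move) (index-reachable moves)

-- Descending to a parity pattern

descend : ℕ → ℕ
descend zero = 1
descend (suc a) = a

adjacent-descend : ∀ {p} (x : Vec ℕ p) → Pointwise Adjacent x (map descend x)
adjacent-descend [] = []
adjacent-descend (zero ∷ x) = inj₁ refl ∷ adjacent-descend x
adjacent-descend (suc a ∷ x) = inj₂ refl ∷ adjacent-descend x

descend-≤ : ∀ {p} {x m : Vec ℕ p} → All (1 ≤_) m → Pointwise _≤_ x m → Pointwise _≤_ (map descend x) m
descend-≤ [] [] = []
descend-≤ {x = zero ∷ _} (1≤m ∷ 1≤ms) (_ ∷ x≤m) = 1≤m ∷ descend-≤ 1≤ms x≤m
descend-≤ {x = suc _ ∷ _} (_ ∷ 1≤ms) (s≤s a≤m ∷ x≤m) = m≤n⇒m≤1+n a≤m ∷ descend-≤ 1≤ms x≤m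

iterate-descend : ∀ {a} k → a ≤ suc k → iterate descend a k ≡ bit (parity (a + k))
iterate-descend {zero} zero _ = refl
iterate-descend {suc zero} zero _ = refl
iterate-descend {zero} (suc k) _ = iterate-descend {1} k (s≤s z≤n)
iterate-descend {suc a} (suc k) (s≤s a≤1+k) =
  trans (iterate-descend k a≤1+k) (cong (bit ∘ parity ∘ suc) (sym (+-suc a k)))

map-iterate-descend : ∀ {p} k {x : Vec ℕ p} → All (_≤ suc k) x →
                      map (λ a → iterate descend a k) x ≡ map (λ c → bit (parity k ℙ.+ c)) (map parity x)
map-iterate-descend k [] = refl
map-iterate-descend k {a ∷ _} (a≤1+k ∷ x≤1+k) = cong₂ _∷_
  (trans (iterate-descend k a≤1+k) (cong bit (trans (+-homo-+ a k) (ℙₚ.+-comm (parity a) (parity k)))))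
  (map-iterate-descend k x≤1+k)

Pointwise-irrelevant : ∀ {A B : Set} {R : A → B → Set} → Irrelevant R → ∀ {p q} → Irrelevant (Pointwise R {p} {q})
Pointwise-irrelevant irr [] [] = refl
Pointwise-irrelevant irr (r ∷ rs) (s ∷ ss) = cong₂ _∷_ (irr r s) (Pointwise-irrelevant irr rs ss)

Point-≡ : ∀ {p} {m : Vec ℕ p} {P Q : Point m} → proj₁ P ≡ proj₁ Q → P ≡ Q
Point-≡ {P = x , x≤m} {_ , x≤m′} refl = cong (x ,_) (Pointwise-irrelevant ≤-irrelevant x≤m x≤m′)

≤-sum : ∀ {p} {x m : Vec ℕ p} → Pointwise _≤_ x m → All (_≤ sum m) x
≤-sum [] = []
≤-sum {m = m ∷ ms} (a≤m ∷ x≤ms) =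
  ≤-trans a≤m (m≤m+n m (sum ms)) ∷ All.map (λ a≤ → ≤-trans a≤ (m≤n+m (sum ms) m)) (≤-sum x≤ms)

module _ {p} {m : Vec ℕ p} (m≥1 : All (1 ≤_) m) where

  descendPoint : Point m → Point m
  descendPoint (x , x≤m) = map descend x , descend-≤ m≥1 x≤m

  reachable-descendPoint : ∀ k P → Reachable m P (iterate descendPoint P k)
  reachable-descendPoint zero P = ε
  reachable-descendPoint (suc k) P = adjacent-descend (proj₁ P) ◅ reachable-descendPoint k (descendPoint P)

  proj₁-descendPoint : ∀ k P → proj₁ (iterate descendPoint P k) ≡ map (λ a → iterate descend a k) (proj₁ P)
  proj₁-descendPoint zero (x , _) = sym (map-id x)
  proj₁-descendPoint (suc k) P@(x , _) =
    trans (proj₁-descendPoint k (descendPoint P)) (sym (map-∘ (λ a → iterate descend a k) descend x))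

  iterate-descendPoint-sum+bit : ∀ c (P : Point m) → proj₁ (iterate descendPoint P (sum m + bit c)) ≡
                                 map (λ q → bit (parity (sum m) ℙ.+ (c ℙ.+ q))) (map parity (proj₁ P))
  iterate-descendPoint-sum+bit c P@(x , x≤m) = begin
    proj₁ (iterate descendPoint P N)                        ≡⟨ proj₁-descendPoint N P ⟩
    map (λ a → iterate descend a N) x                       ≡⟨ map-iterate-descend N (All.map (λ a≤ → ≤-trans a≤ (m≤n⇒m≤1+n (m≤m+n _ _))) (≤-sum x≤m)) ⟩
    map (λ q → bit (parity N ℙ.+ q)) (map parity x)         ≡⟨ map-cong (λ q → cong bit (shift q)) (map parity x) ⟩
    map (λ q → bit (parity (sum m) ℙ.+ (c ℙ.+ q))) (map parity x) ∎
    where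
    open ≡-Reasoning
    N = sum m + bit c
    shift : ∀ q → parity N ℙ.+ q ≡ parity (sum m) ℙ.+ (c ℙ.+ q)
    shift q = trans (cong (ℙ._+ q) (trans (+-homo-+ (sum m) (bit c)) (cong (parity (sum m) ℙ.+_) (parity-bit c))))
                    (ℙₚ.+-assoc (parity (sum m)) c q)

reachable-if-relative≡ : ∀ {q} {m : Vec ℕ (suc q)} → All (1 ≤_) m → ∀ (P Q : Point m) →
                         relative (map parity (proj₁ P)) ≡ relative (map parity (proj₁ Q)) → Reachable m P Q
reachable-if-relative≡ {m = m} m≥1 P@(x , _) Q@(y , _) eq =
  reachable-descendPoint m≥1 (sum m + 0) P
    ◅◅ subst (λ R → Reachable m R Q) (sym meet) (reverse (Pointwise.sym swap) (reachable-descendPoint m≥1 (sum m + bit c) Q))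
  where
  open ≡-Reasoning
  c = head (map parity x) ℙ.+ head (map parity y)
  meet : iterate (descendPoint m≥1) P (sum m + 0) ≡ iterate (descendPoint m≥1) Q (sum m + bit c)
  meet = Point-≡ (begin
    proj₁ (iterate (descendPoint m≥1) P (sum m + 0))                  ≡⟨ iterate-descendPoint-sum+bit m≥1 0ℙ P ⟩
    map (λ q → bit (parity (sum m) ℙ.+ q)) (map parity x)               ≡⟨ cong (map _) (relative-injective (map parity x) (map parity y) eq) ⟩
    map (λ q → bit (parity (sum m) ℙ.+ q)) (map (c ℙ.+_) (map parity y)) ≡⟨ sym (map-∘ _ (c ℙ.+_) (map parity y)) ⟩
    map (λ q → bit (parity (sum m) ℙ.+ (c ℙ.+ q))) (map parity y)       ≡⟨ sym (iterate-descendPoint-sum+bit m≥1 c Q) ⟩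
    proj₁ (iterate (descendPoint m≥1) Q (sum m + bit c))                ∎)

reachable⇔index≡ : ∀ {q} {m : Vec ℕ (suc q)} → All (1 ≤_) m → (P Q : Point m) →
                   Reachable m P Q ⇔ (index (proj₁ P) ≡ index (proj₁ Q))
reachable⇔index≡ m≥1 P@(x , _) Q@(y , _) = mk⇔ index-reachable λ eq →
  reachable-if-relative≡ m≥1 P Q (trans (to (index≡⇔relative≡ x _) eq) (sym (to (index≡⇔relative≡ y _) refl)))

count : Parity → ℕ → ℕ
count 0ℙ m = ⌈ suc m /2⌉
count 1ℙ m = ⌊ suc m /2⌋

count-suc-suc : ∀ p m → count p (suc (suc m)) ≡ suc (count p m)
count-suc-suc 0ℙ m = refl
count-suc-suc 1ℙ m = refl

count-positive : ∀ p {m} → 1 ≤ m → 1 ≤ count p m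
count-positive 0ℙ _ = s≤s z≤n
count-positive 1ℙ (s≤s _) = s≤s z≤n

nthOfParity : Parity → ℕ → ℕ
nthOfParity p zero = bit p
nthOfParity p (suc k) = suc (suc (nthOfParity p k))

parity-nthOfParity : ∀ p k → parity (nthOfParity p k) ≡ p
parity-nthOfParity p zero = parity-bit p
parity-nthOfParity p (suc k) = parity-nthOfParity p k

⌊nthOfParity/2⌋ : ∀ p k → ⌊ nthOfParity p k /2⌋ ≡ k
⌊nthOfParity/2⌋ 0ℙ zero = refl
⌊nthOfParity/2⌋ 1ℙ zero = refl
⌊nthOfParity/2⌋ p (suc k) = cong suc (⌊nthOfParity/2⌋ p k)

nthOfParity-⌊/2⌋ : ∀ {p} a → parity a ≡ p → nthOfParity p ⌊ a /2⌋ ≡ a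
nthOfParity-⌊/2⌋ zero refl = refl
nthOfParity-⌊/2⌋ (suc zero) refl = refl
nthOfParity-⌊/2⌋ (suc (suc a)) refl = cong (suc ∘ suc) (nthOfParity-⌊/2⌋ a refl)

nthOfParity≤⇒<count : ∀ p k {m} → nthOfParity p k ≤ m → k < count p m
nthOfParity≤⇒<count 0ℙ zero _ = s≤s z≤n
nthOfParity≤⇒<count 1ℙ zero (s≤s _) = s≤s z≤n
nthOfParity≤⇒<count p (suc k) {suc (suc m)} (s≤s (s≤s le)) =
  subst (suc k <_) (sym (count-suc-suc p m)) (s≤s (nthOfParity≤⇒<count p k le))

<count⇒nthOfParity≤ : ∀ p k {m} → k < count p m → nthOfParity p k ≤ m
<count⇒nthOfParity≤ 0ℙ zero _ = z≤n
<count⇒nthOfParity≤ 1ℙ zero {suc m} _ = s≤s z≤n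
<count⇒nthOfParity≤ 0ℙ (suc k) {zero} (s≤s ())
<count⇒nthOfParity≤ 0ℙ (suc k) {suc zero} (s≤s ())
<count⇒nthOfParity≤ 1ℙ (suc k) {suc zero} (s≤s ())
<count⇒nthOfParity≤ p (suc k) {suc (suc m)} lt =
  s≤s (s≤s (<count⇒nthOfParity≤ p k (s≤s⁻¹ (subst (suc k <_) (count-suc-suc p m) lt))))

ParityClass : ℕ → Parity → Set
ParityClass m p = Σ ℕ (λ a → a ≤ m × parity a ≡ p)

ParityClass-≡ : ∀ {m p} {A B : ParityClass m p} → proj₁ A ≡ proj₁ B → A ≡ B
ParityClass-≡ {A = a , a≤m , e} {_ , a≤m′ , e′} refl = cong₂ (λ u v → a , u , v) (≤-irrelevant a≤m a≤m′) (uip e e′)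

Fin-count↔ParityClass : ∀ p m → Fin (count p m) ↔ ParityClass m p
Fin-count↔ParityClass p m = mk↔ₛ′ nth position nth∘position position∘nth
  where
  nth : Fin (count p m) → ParityClass m p
  nth i = nthOfParity p (toℕ i) , <count⇒nthOfParity≤ p (toℕ i) (toℕ<n i) , parity-nthOfParity p (toℕ i)
  half<count : ((a , _) : ParityClass m p) → ⌊ a /2⌋ < count p m
  half<count (a , a≤m , e) = nthOfParity≤⇒<count p ⌊ a /2⌋ (subst (_≤ m) (sym (nthOfParity-⌊/2⌋ a e)) a≤m)
  position : ParityClass m p → Fin (count p m)
  position A = fromℕ< (half<count A)
  nth∘position : ∀ A → nth (position A) ≡ A
  nth∘position A@(a , _ , e) = ParityClass-≡ (trans (cong (nthOfParity p) (toℕ-fromℕ< (half<count A))) (nthOfParity-⌊/2⌋ a e))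
  position∘nth : ∀ i → position (nth i) ≡ i
  position∘nth i = toℕ-injective (trans (toℕ-fromℕ< _) (⌊nthOfParity/2⌋ p (toℕ i)))

-- Boxes of points with prescribed parities

ParityBox : ∀ {k} → Vec ℕ k → Vec Parity k → Set
ParityBox m ps = Σ (Point m) (λ P → map parity (proj₁ P) ≡ ps)

boxSize : ∀ {k} → Vec Parity k → Vec ℕ k → ℕ
boxSize [] [] = 1
boxSize (p ∷ ps) (m ∷ ms) = count p m * boxSize ps ms

boxSize-positive : ∀ {k} (ps : Vec Parity k) {m} → All (1 ≤_) m → 1 ≤ boxSize ps m
boxSize-positive [] [] = s≤s z≤n
boxSize-positive (p ∷ ps) (m≥1 ∷ ms≥1) = *-mono-≤ (count-positive p m≥1) (boxSize-positive ps ms≥1)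

ParityClass×ParityBox↔ParityBox : ∀ {k} m p (ms : Vec ℕ k) ps →
                                   (ParityClass m p × ParityBox ms ps) ↔ ParityBox (m ∷ ms) (p ∷ ps)
ParityClass×ParityBox↔ParityBox m p ms ps = mk↔ₛ′ join split join∘split split∘join
  where
  join : ParityClass m p × ParityBox ms ps → ParityBox (m ∷ ms) (p ∷ ps)
  join ((a , a≤m , e) , (x , x≤ms) , es) = (a ∷ x , a≤m ∷ x≤ms) , cong₂ _∷_ e es
  split : ParityBox (m ∷ ms) (p ∷ ps) → ParityClass m p × ParityBox ms ps
  split ((a ∷ x , a≤m ∷ x≤ms) , e) = (a , a≤m , ∷-injectiveˡ e) , (x , x≤ms) , ∷-injectiveʳ e
  join∘split : ∀ B → join (split B) ≡ B
  join∘split ((_ ∷ _ , _ ∷ _) , e) = cong (_ ,_) (uip _ e)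
  split∘join : ∀ C → split (join C) ≡ C
  split∘join ((a , a≤m , e) , (x , x≤ms) , es) = cong₂ (λ u v → (a , a≤m , u) , (x , x≤ms) , v) (uip _ e) (uip _ es)

Fin-boxSize↔ParityBox : ∀ {k} (ps : Vec Parity k) m → Fin (boxSize ps m) ↔ ParityBox m ps
Fin-boxSize↔ParityBox [] [] =
  mk↔ₛ′ (λ _ → ([] , []) , refl) (λ _ → 0F) (λ { (([] , []) , refl) → refl }) (λ { 0F → refl ; (Fin.suc ()) })
Fin-boxSize↔ParityBox (p ∷ ps) (m ∷ ms) =
  ↔-trans *↔× (↔-trans (Fin-count↔ParityClass p m ×-↔ Fin-boxSize↔ParityBox ps ms) (ParityClass×ParityBox↔ParityBox m p ms ps))

-- The orbit S_δ as a union of two boxes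

Σ-Parity↔⊎ : ∀ {ℓ} {F : Parity → Set ℓ} → Σ Parity F ↔ (F 0ℙ ⊎ F 1ℙ)
Σ-Parity↔⊎ = mk↔ₛ′
  (λ { (0ℙ , f) → inj₁ f ; (1ℙ , f) → inj₂ f })
  (λ { (inj₁ f) → 0ℙ , f ; (inj₂ f) → 1ℙ , f })
  (λ { (inj₁ _) → refl ; (inj₂ _) → refl })
  (λ { (0ℙ , _) → refl ; (1ℙ , _) → refl })

S↔Σ-ParityBox : ∀ {q} (m : Vec ℕ (suc q)) δ →
                S[_] {m = m} δ ↔ Σ Parity (λ c → ParityBox m (fromRelative c (map fromFin₂ δ)))
S↔Σ-ParityBox m δ = mk↔ₛ′ classify forget classify∘forget forget∘classify
  where
  ρ = map fromFin₂ δ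
  Boxes = Σ Parity (λ c → ParityBox m (fromRelative c ρ))
  classify : S[_] {m = m} δ → Boxes
  classify (P@(x , _) , e) =
    head (map parity x) , P , trans (sym (fromRelative-relative (map parity x))) (cong (fromRelative _) (to (index≡⇔relative≡ x δ) e))
  forget : Boxes → S[_] {m = m} δ
  forget (c , P@(x , _) , e) = P , from (index≡⇔relative≡ x δ) (trans (cong relative e) (relative-fromRelative c ρ))
  same-c : ∀ {c c′} {P} {e e′} → c ≡ c′ → _≡_ {A = Boxes} (c , P , e) (c′ , P , e′)
  same-c {c} {P = P} refl = cong (λ e → c , P , e) (uip _ _)
  classify∘forget : ∀ B → classify (forget B) ≡ B
  classify∘forget (c , P , e) = same-c (cong head e)
  forget∘classify : ∀ A → forget (classify A) ≡ A
  forget∘classify (P , e) = cong (P ,_) (uip _ e)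

n/2≡⌊n/2⌋ : ∀ n → n / 2 ≡ ⌊ n /2⌋
n/2≡⌊n/2⌋ zero = refl
n/2≡⌊n/2⌋ (suc zero) = refl
n/2≡⌊n/2⌋ (suc (suc n)) = trans (m/n≡1+[m∸n]/n {suc (suc n)} {2} (s≤s (s≤s z≤n))) (cong suc (n/2≡⌊n/2⌋ n))

even⇒⌈n/2⌉≡⌊n/2⌋ : ∀ n → parity n ≡ 0ℙ → ⌈ n /2⌉ ≡ ⌊ n /2⌋
even⇒⌈n/2⌉≡⌊n/2⌋ zero _ = refl
even⇒⌈n/2⌉≡⌊n/2⌋ (suc (suc n)) even = cong suc (even⇒⌈n/2⌉≡⌊n/2⌋ n even)

factor-bit : ∀ p m → factor (bit p) m ≡ + count p m
factor-bit p m = trans (cong (λ d → ((+ suc m) ℤ.+ neg1^ (bit p) ℤ.* (+ toℕ d)) /ℕ 2) ([n]₂≡toFin₂-parity (suc m)))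
                       (halve p (parity (suc m)) refl)
  where
  halve : ∀ p c → parity (suc m) ≡ c → ((+ suc m) ℤ.+ neg1^ (bit p) ℤ.* (+ toℕ (toFin₂ c))) /ℕ 2 ≡ + count p m
  halve 0ℙ 0ℙ even = cong +_ (trans (cong (_/ 2) (+-identityʳ (suc m)))
                                    (trans (n/2≡⌊n/2⌋ (suc m)) (sym (even⇒⌈n/2⌉≡⌊n/2⌋ (suc m) even))))
  halve 0ℙ 1ℙ _ = cong +_ (trans (cong (_/ 2) (+-comm (suc m) 1)) (n/2≡⌊n/2⌋ (suc (suc m))))
  halve 1ℙ 0ℙ _ = cong +_ (trans (cong (_/ 2) (+-identityʳ (suc m))) (n/2≡⌊n/2⌋ (suc m)))
  halve 1ℙ 1ℙ odd = cong +_ (trans (n/2≡⌊n/2⌋ m)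
                                   (sym (even⇒⌈n/2⌉≡⌊n/2⌋ m (ℙₚ.⁻¹-injective (trans (sym (parity-suc m)) odd)))))

prodFactors-bit : ∀ {k} (ps : Vec Parity k) m → prodFactors (map bit ps) m ≡ + boxSize ps m
prodFactors-bit [] [] = refl
prodFactors-bit (p ∷ ps) (m ∷ ms) =
  trans (cong₂ ℤ._*_ (factor-bit p m) (prodFactors-bit ps ms)) (sym (pos-* (count p m) (boxSize ps ms)))

map-bit-fromRelative : ∀ {q} c (δ : Vec (Fin 2) q) →
                       map bit (fromRelative c (map fromFin₂ δ)) ≡ bit c ∷ map (λ d → bit (c ℙ.+ fromFin₂ d)) δ
map-bit-fromRelative c δ = cong (bit c ∷_) (trans (cong (map bit) (sym (map-∘ (c ℙ.+_) fromFin₂ δ))) (sym (map-∘ bit _ δ)))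

exps₀≡map-bit : ∀ {q} (δ : Vec (Fin 2) q) → exps₀ δ ≡ map bit (fromRelative 0ℙ (map fromFin₂ δ))
exps₀≡map-bit δ = trans (cong (0 ∷_) (map-cong (λ { 0F → refl ; 1F → refl }) δ)) (sym (map-bit-fromRelative 0ℙ δ))

exps₁≡map-bit : ∀ {q} (δ : Vec (Fin 2) q) → exps₁ δ ≡ map bit (fromRelative 1ℙ (map fromFin₂ δ))
exps₁≡map-bit δ = trans (cong (1 ∷_) (map-cong (λ { 0F → refl ; 1F → refl }) δ)) (sym (map-bit-fromRelative 1ℙ δ))

orbitSize : ∀ {q} (m : Vec ℕ (suc q)) → All (1 ≤_) m → (δ : Vec (Fin 2) q) →
            Σ ℕ (λ N → (Fin N ↔ S[_] {m = m} δ) × (1 ≤ N) × (+ N ≡ orbitSizeFormula m δ))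
orbitSize m m≥1 δ = A + B , Fin↔S , ≤-trans (boxSize-positive ps₀ m≥1) (m≤m+n A B) , formula
  where
  open EquationalReasoning
  ps₀ = fromRelative 0ℙ (map fromFin₂ δ)
  ps₁ = fromRelative 1ℙ (map fromFin₂ δ)
  A = boxSize ps₀ m
  B = boxSize ps₁ m
  Fin↔S : Fin (A + B) ↔ S[_] {m = m} δ
  Fin↔S = begin
    Fin (A + B)                                         ↔⟨ +↔⊎ ⟩
    (Fin A ⊎ Fin B)                                     ↔⟨ Fin-boxSize↔ParityBox ps₀ m ⊎-↔ Fin-boxSize↔ParityBox ps₁ m ⟩
    (ParityBox m ps₀ ⊎ ParityBox m ps₁)                 ↔⟨ Σ-Parity↔⊎ ⟨
    Σ Parity (λ c → ParityBox m (fromRelative c (map fromFin₂ δ))) ↔⟨ S↔Σ-ParityBox m δ ⟨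
    S[_] {m = m} δ                                      ∎
  formula : + (A + B) ≡ orbitSizeFormula m δ
  formula = trans (pos-+ A B) (sym (cong₂ ℤ._+_
    (trans (cong (λ es → prodFactors es m) (exps₀≡map-bit δ)) (prodFactors-bit ps₀ m))
    (trans (cong (λ es → prodFactors es m) (exps₁≡map-bit δ)) (prodFactors-bit ps₁ m))))

theorem4p18 : (q : ℕ) → 1 ≤ q → (m : Vec ℕ (suc q)) → All (λ mi → 1 ≤ mi) m →
    ((P Q : Point m) → Reachable m P Q ⇔ (index (proj₁ P) ≡ index (proj₁ Q)))
    × ((δ : Vec (Fin 2) q) →
        Σ ℕ (λ N → (Fin N ↔ S[_] {m = m} δ)
                 × (1 ≤ N)
                 × (+ N ≡ orbitSizeFormula m δ)))
theorem4p18 q _ m m≥1 = reachable⇔index≡ m≥1 , orbitSize m m≥1
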